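{- Let $t\ge 3$ and let $2\le \ell_1\le\ell_2\le\cdots\le\ell_t$ be integers with $\ell_1\le 3$. Then $p(\ell_1,\ldots,\ell_t)\le \left\lfloor\frac{\ell_1+2\ell_2+\cdots+2^{t-1}\ell_t-2}{2^t-2}\right\rfloor$.
   Context: $P_m$ denotes the path with $m$ vertices. For integers $k\ge 2$ and $\ell_1,\ldots,\ell_k\ge 2$, $p(\ell_1,\ldots,\ell_k)$ denotes the least integer $n$ such that for every colouring of the edges of $K_n$ with colours $1,\ldots,k$ there is some $i\in\{1,\ldots,k\}$ and a copy of $P_{\ell_i}$ in $K_n$ none of whose edges has colour $i$. -}

module Defs where

open import Data.Nat using (ℕ; zero; suc; _+_; _*_; _∸_; _^_; _≤_; _/_)
open import Data.Fin using (Fin; toℕ)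
open import Data.Vec using (sum; tabulate)
open import Data.Product using (Σ; _×_)
open import Relation.Binary.PropositionalEquality using (_≡_; _≢_)
open import Function.Definitions using (Injective)

-- An edge-colouring of K_n with k colours: a symmetric colour function on
-- pairs of vertices (values on the diagonal are irrelevant).
record Colouring (n k : ℕ) : Set where
  field
    col  : Fin n → Fin n → Fin k
    symm : ∀ x y → col x y ≡ col y x
open Colouring public

PathAvoiding : ∀ {n k} → Colouring n k → ℕ → Fin k → Set
PathAvoiding {n} c m i =
  Σ (Fin m → Fin n) λ v →
    Injective _≡_ _≡_ v ×
    (∀ (a b : Fin m) → toℕ b ≡ suc (toℕ a) → col c (v a) (v b) ≢ i)

Good : (k : ℕ) → (Fin k → ℕ) → ℕ → Set
Good k ℓ n = ∀ (c : Colouring n k) → Σ (Fin k) λ i → PathAvoiding c (ℓ i) i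

-- p(ℓ) ≤ B  (p is the least n with Good), i.e. some n ≤ B is Good.
PathRamseyAtMost : (k : ℕ) → (Fin k → ℕ) → ℕ → Set
PathRamseyAtMost k ℓ B = Σ ℕ λ n → n ≤ B × Good k ℓ n

-- ℓ_1 + 2 ℓ_2 + ... + 2^{t-1} ℓ_t  (0-indexed: Σ_i 2^i ℓ(i))
weightedSum : (t : ℕ) → (Fin t → ℕ) → ℕ
weightedSum t ℓ = sum (tabulate {n = t} λ i → 2 ^ toℕ i * ℓ i)

-- floor division (divisor 0 never occurs in the statement since t ≥ 3)
floorDiv : ℕ → ℕ → ℕ
floorDiv m zero = zero
floorDiv m (suc d) = m / suc d

-- Take n = ℓ₂ and colour K_n.  Let R be the graph of colour-2 edges.  Either R
-- contains a path on min(3, n) vertices, whose edges all avoid colour 1, and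
-- ℓ₁ ≤ min(3, ℓ₂); or R has no such path, i.e. it is a matching, and then its
-- complement has a Hamiltonian path, which is a P_{ℓ₂} avoiding colour 2.  Hence
-- p(ℓ) ≤ ℓ₂, and ℓ₂ (2^t − 2) = Σ_{i ≥ 2} 2^{i-1} ℓ₂ ≤ Σ_{i ≥ 2} 2^{i-1} ℓ_i
-- ≤ Σ_i 2^{i-1} ℓ_i − 2 bounds ℓ₂ by the stated quotient.
module Submission where

open import Defs
open import Data.Nat using (ℕ; zero; suc; _+_; _*_; _∸_; _^_; _⊓_; _≤_; _<_; z≤n; s≤s)
open import Data.Nat.Properties
open import Data.Nat.DivMod using (_/_; m*n/n≡m; /-mono-≤)
open import Data.Fin using (Fin; toℕ; inject≤) renaming (_≤_ to _≤ᶠ_; zero to fzero; suc to fsuc; _≟_ to _≟ᶠ_)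
open import Data.Fin.Properties using (toℕ-inject≤; inject≤-injective)
open import Data.List using (List; []; _∷_; _++_; length; lookup; allFin)
open import Data.List.Properties using (length-++; length-tabulate)
open import Data.List.Membership.Propositional.Properties using (∈-lookup)
open import Data.List.Relation.Unary.All as All using ([]; _∷_)
open import Data.List.Relation.Unary.AllPairs using ([]; _∷_)
open import Data.List.Relation.Unary.Linked as Linked using (Linked; []; [-]; _∷_)
open import Data.List.Relation.Unary.Unique.Propositional using (Unique)
open import Data.List.Relation.Unary.Unique.Propositional.Properties using (allFin⁺)
open import Data.List.Relation.Binary.Permutation.Propositional using (_↭_; ↭-refl; ↭-prep; ↭-trans; ↭-sym; ↭⇒↭ₛ)
open import Data.List.Relation.Binary.Permutation.Propositional.Properties using (↭-length; shift; ++-comm)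
import Data.List.Relation.Binary.Permutation.Setoid.Properties as PermutationₛProperties
import Data.Vec as Vec
open import Data.Vec.Properties using (tabulate-cong)
open import Data.Empty using (⊥-elim)
open import Data.Product using (Σ; _×_; _,_)
open import Data.Sum as Sum using (_⊎_; inj₁; inj₂)
open import Function using (_∘_; const)
open import Level using (Level; _⊔_; 0ℓ)
open import Relation.Binary using (Rel; Decidable; Symmetric; _⇒_)
open import Relation.Binary.PropositionalEquality using (_≡_; _≢_; refl; sym; trans; cong; cong₂; subst; setoid; ≢-sym; module ≡-Reasoning)
open import Relation.Nullary using (¬_; yes; no)

private
  variable
    a r : Level
    A : Set a
    xs : List A

lookup-injective : Unique xs → ∀ {i j} → lookup xs i ≡ lookup xs j → i ≡ j
lookup-injective {xs = _ ∷ _} _ {fzero} {fzero} _ = refl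
lookup-injective {xs = _ ∷ _} (x∉ ∷ _) {fzero} {fsuc j} x≡ = ⊥-elim (All.lookup x∉ (∈-lookup j) x≡)
lookup-injective {xs = _ ∷ _} (x∉ ∷ _) {fsuc i} {fzero} ≡x = ⊥-elim (All.lookup x∉ (∈-lookup i) (sym ≡x))
lookup-injective {xs = _ ∷ _} (_ ∷ u) {fsuc i} {fsuc j} eq = cong fsuc (lookup-injective u eq)

Linked-lookup : ∀ {S : Rel A r} → Linked S xs → ∀ i j → toℕ j ≡ suc (toℕ i) →
                S (lookup xs i) (lookup xs j)
Linked-lookup (Sxy ∷ _)  fzero    (fsuc fzero) refl = Sxy
Linked-lookup (_ ∷ Sxs) (fsuc i) (fsuc j)     eq   = Linked-lookup Sxs i j (suc-injective eq)
Linked-lookup (_ ∷ _)   fzero    (fsuc (fsuc _)) ()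
Linked-lookup [-]       fzero    fzero ()

unique-resp-↭ : {A : Set a} {xs ys : List A} → xs ↭ ys → Unique xs → Unique ys
unique-resp-↭ {A = A} σ = PermutationₛProperties.Unique-resp-↭ (setoid A) (↭⇒↭ₛ σ)

record Path {A : Set a} (S : Rel A r) (m : ℕ) : Set (a ⊔ r) where
  constructor path
  field
    vertices : List A
    distinct : Unique vertices
    linked   : Linked S vertices
    length≡  : length vertices ≡ m

Path-map : ∀ {S T : Rel A r} {m} → S ⇒ T → Path S m → Path T m
Path-map S⇒T (path vs u l e) = path vs u (Linked.map S⇒T l) e

module PathOrSpanningPath {A : Set a} {R : Rel A r} (R? : Decidable R) (R-sym : Symmetric R) where

  _≁_ : Rel A r
  x ≁ y = ¬ R x y

  SpanningPath : List A → Set (a ⊔ r)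
  SpanningPath vs = Σ (List A) λ p → p ↭ vs × Linked _≁_ p

  SpanningPath-resp-↭ : {xs ys : List A} → xs ↭ ys → SpanningPath xs → SpanningPath ys
  SpanningPath-resp-↭ σ (p , p↭ , l) = p , ↭-trans p↭ σ , l

  SpanningPath⇒Path : {xs : List A} → Unique xs → SpanningPath xs → Path _≁_ (length xs)
  SpanningPath⇒Path u (p , p↭ , l) = path p (unique-resp-↭ (↭-sym p↭) u) l (↭-length p↭)

  path₃ : ∀ {x y z} → R x y → R y z → y ≢ x → y ≢ z → x ≢ z → Path R 3
  path₃ {x} {y} {z} xy yz y≢x y≢z x≢z =
    path (x ∷ y ∷ z ∷ []) ((≢-sym y≢x ∷ x≢z ∷ []) ∷ (y≢z ∷ []) ∷ [] ∷ []) (xy ∷ yz ∷ [-]) refl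

  -- v goes in front of h, or else between the 2nd and 3rd vertex, unless v has
  -- two R-neighbours among the first three vertices.
  insert : ∀ v p → Unique (v ∷ p) → Linked _≁_ p → 2 ≤ length p → Path R 3 ⊎ SpanningPath (v ∷ p)
  insert v (h ∷ y ∷ p) u l _ with R? v h
  ... | no v≁h = inj₂ (v ∷ h ∷ y ∷ p , ↭-refl , v≁h ∷ l)
  ... | yes vh with R? v y | p | u
  ...   | yes vy | _ | (v≢h ∷ v≢y ∷ _) ∷ (h≢y ∷ _) ∷ _ = inj₁ (path₃ (R-sym vh) vy v≢h v≢y h≢y)
  ...   | no v≁y | [] | _ = inj₂ (h ∷ y ∷ v ∷ [] , shift v (h ∷ y ∷ []) [] , Linked.head l ∷ (v≁y ∘ R-sym) ∷ [-])
  ...   | no v≁y | z ∷ q | (v≢h ∷ _ ∷ v≢z ∷ _) ∷ (_ ∷ h≢z ∷ _) ∷ _ with R? v z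
  ...     | yes vz = inj₁ (path₃ (R-sym vh) vz v≢h v≢z h≢z)
  ...     | no v≁z = inj₂ (h ∷ y ∷ v ∷ z ∷ q , shift v (h ∷ y ∷ []) (z ∷ q) ,
                           Linked.head l ∷ (v≁y ∘ R-sym) ∷ v≁z ∷ Linked.tail (Linked.tail l))
  insert _ [] _ _ ()
  insert _ (_ ∷ []) _ _ (s≤s ())

  extend : ∀ ws p → Unique (ws ++ p) → Linked _≁_ p → 2 ≤ length p → Path R 3 ⊎ SpanningPath (ws ++ p)
  extend [] p _ l _ = inj₂ (p , ↭-refl , l)
  extend (w ∷ ws) p u@(_ ∷ u′) l 2≤p with extend ws p u′ l 2≤p
  ... | inj₁ c = inj₁ c
  ... | inj₂ (q , q↭ , lq) =
    Sum.map₂ (SpanningPath-resp-↭ (↭-prep w q↭))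
             (insert w q (unique-resp-↭ (↭-prep w (↭-sym q↭)) u) lq 2≤q)
    where
    2≤q : 2 ≤ length q
    2≤q = ≤-trans 2≤p (≤-trans (m≤n+m (length p) (length ws))
            (≤-reflexive (sym (trans (↭-length q↭) (length-++ ws)))))

  pathOrSpanningPath : ∀ vs → Unique vs → 2 ≤ length vs → Path R (3 ⊓ length vs) ⊎ SpanningPath vs
  pathOrSpanningPath (a ∷ b ∷ []) u _ with R? a b
  ... | yes ab = inj₁ (path (a ∷ b ∷ []) u (ab ∷ [-]) refl)
  ... | no a≁b = inj₂ (a ∷ b ∷ [] , ↭-refl , a≁b ∷ [-])
  pathOrSpanningPath (a ∷ b ∷ c ∷ vs) u _ with R? a b | R? b c | u
  ... | no a≁b | _ | _ =
    Sum.map₂ (SpanningPath-resp-↭ (++-comm (c ∷ vs) (a ∷ b ∷ [])))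
             (extend (c ∷ vs) (a ∷ b ∷ []) (unique-resp-↭ (++-comm (a ∷ b ∷ []) (c ∷ vs)) u) (a≁b ∷ [-]) ≤-refl)
  ... | yes ab | yes bc | (a≢b ∷ a≢c ∷ _) ∷ (b≢c ∷ _) ∷ _ = inj₁ (path₃ ab bc (≢-sym a≢b) b≢c a≢c)
  ... | yes _ | no b≁c | _ =
    Sum.map₂ (SpanningPath-resp-↭ (↭-prep a (++-comm vs (b ∷ c ∷ []))))
             (extend (a ∷ vs) (b ∷ c ∷ []) (unique-resp-↭ (↭-prep a (++-comm (b ∷ c ∷ []) vs)) u) (b≁c ∷ [-]) ≤-refl)
  pathOrSpanningPath [] _ ()
  pathOrSpanningPath (_ ∷ []) _ (s≤s ())

module _ {n k} (c : Colouring n k) where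

  Avoiding : Fin k → Rel (Fin n) 0ℓ
  Avoiding i x y = col c x y ≢ i

  Path⇒PathAvoiding : ∀ {i m} → Path (Avoiding i) m → PathAvoiding c m i
  Path⇒PathAvoiding (path p u l refl) = lookup p , lookup-injective u , Linked-lookup l

  PathAvoiding-≤ : ∀ {i m m′} → m ≤ m′ → PathAvoiding c m′ i → PathAvoiding c m i
  PathAvoiding-≤ {m = m} {m′} m≤m′ (v , v-inj , v-avoids) =
    v ∘ inject≤′ , inject≤-injective m≤m′ m≤m′ _ _ ∘ v-inj ,
    λ a b b≡1+a → v-avoids (inject≤′ a) (inject≤′ b)
                   (trans (toℕ-inject≤ b m≤m′) (trans b≡1+a (cong suc (sym (toℕ-inject≤ a m≤m′)))))
    where
    inject≤′ : Fin m → Fin m′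
    inject≤′ x = inject≤ x m≤m′

  module ColourClass (j : Fin k) =
    PathOrSpanningPath {R = λ x y → col c x y ≡ j} (λ x y → col c x y ≟ᶠ j) (λ {x} {y} → trans (symm c y x))

length-allFin : ∀ n → length (allFin n) ≡ n
length-allFin n = length-tabulate (λ x → x)

Good-ℓⱼ : ∀ {k} (ℓ : Fin k → ℕ) (i j : Fin k) → j ≢ i →
          2 ≤ ℓ j → ℓ i ≤ 3 → ℓ i ≤ ℓ j → Good k ℓ (ℓ j)
Good-ℓⱼ ℓ i j j≢i 2≤ℓj ℓi≤3 ℓi≤ℓj c
  with ColourClass.pathOrSpanningPath c j (allFin (ℓ j)) (allFin⁺ (ℓ j))
         (subst (2 ≤_) (sym (length-allFin (ℓ j))) 2≤ℓj)
... | inj₁ path-j =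
  i , PathAvoiding-≤ c (⊓-glb ℓi≤3 (subst (ℓ i ≤_) (sym (length-allFin (ℓ j))) ℓi≤ℓj))
                     (Path⇒PathAvoiding c (Path-map (λ xy → j≢i ∘ trans (sym xy)) path-j))
... | inj₂ spanning =
  j , Path⇒PathAvoiding c (subst (Path (Avoiding c j)) (length-allFin (ℓ j))
                              (ColourClass.SpanningPath⇒Path c j (allFin⁺ (ℓ j)) spanning))

sum-tabulate-*ˡ : ∀ {t} m (f : Fin t → ℕ) → Vec.sum (Vec.tabulate (λ i → m * f i)) ≡ m * Vec.sum (Vec.tabulate f)
sum-tabulate-*ˡ {zero}  m f = sym (*-zeroʳ m)
sum-tabulate-*ˡ {suc t} m f = begin
  m * f fzero + Vec.sum (Vec.tabulate (λ i → m * f (fsuc i))) ≡⟨ cong (m * f fzero +_) (sum-tabulate-*ˡ m (f ∘ fsuc)) ⟩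
  m * f fzero + m * Vec.sum (Vec.tabulate (f ∘ fsuc))        ≡⟨ *-distribˡ-+ m (f fzero) _ ⟨
  m * Vec.sum (Vec.tabulate f)                                ∎
  where open ≡-Reasoning

weightedSum-suc : ∀ t (ℓ : Fin (suc t) → ℕ) → weightedSum (suc t) ℓ ≡ ℓ fzero + 2 * weightedSum t (ℓ ∘ fsuc)
weightedSum-suc t ℓ = begin
  1 * ℓ fzero + Vec.sum (Vec.tabulate (λ i → (2 * 2 ^ toℕ i) * ℓ (fsuc i)))
    ≡⟨ cong₂ _+_ (*-identityˡ (ℓ fzero))
                 (cong Vec.sum (tabulate-cong (λ i → *-assoc 2 (2 ^ toℕ i) (ℓ (fsuc i))))) ⟩
  ℓ fzero + Vec.sum (Vec.tabulate (λ i → 2 * (2 ^ toℕ i * ℓ (fsuc i))))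
    ≡⟨ cong (ℓ fzero +_) (sum-tabulate-*ˡ 2 (λ i → 2 ^ toℕ i * ℓ (fsuc i))) ⟩
  ℓ fzero + 2 * weightedSum t (ℓ ∘ fsuc) ∎
  where open ≡-Reasoning

weightedSum-mono-≤ : ∀ t {f g : Fin t → ℕ} → (∀ i → f i ≤ g i) → weightedSum t f ≤ weightedSum t g
weightedSum-mono-≤ zero    _   = z≤n
weightedSum-mono-≤ (suc t) {f} {g} f≤g = begin
  weightedSum (suc t) f                  ≡⟨ weightedSum-suc t f ⟩
  f fzero + 2 * weightedSum t (f ∘ fsuc) ≤⟨ +-mono-≤ (f≤g fzero) (*-monoʳ-≤ 2 (weightedSum-mono-≤ t (f≤g ∘ fsuc))) ⟩
  g fzero + 2 * weightedSum t (g ∘ fsuc) ≡⟨ weightedSum-suc t g ⟨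
  weightedSum (suc t) g                  ∎
  where open ≤-Reasoning

-- Σ_{i<t} 2^i = 2^t − 1, stated without truncated subtraction.
weightedSum-const : ∀ t L → weightedSum t (const L) + L ≡ 2 ^ t * L
weightedSum-const zero    L = sym (*-identityˡ L)
weightedSum-const (suc t) L = begin
  weightedSum (suc t) (const L) + L      ≡⟨ cong (_+ L) (weightedSum-suc t (const L)) ⟩
  L + 2 * weightedSum t (const L) + L    ≡⟨ cong (_+ L) (+-comm L _) ⟩
  2 * weightedSum t (const L) + L + L    ≡⟨ +-assoc (2 * weightedSum t (const L)) L L ⟩
  2 * weightedSum t (const L) + (L + L)  ≡⟨ cong (λ m → 2 * weightedSum t (const L) + (L + m)) (+-identityʳ L) ⟨
  2 * weightedSum t (const L) + 2 * L    ≡⟨ *-distribˡ-+ 2 (weightedSum t (const L)) L ⟨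
  2 * (weightedSum t (const L) + L)      ≡⟨ cong (2 *_) (weightedSum-const t L) ⟩
  2 * (2 ^ t * L)                        ≡⟨ *-assoc 2 (2 ^ t) L ⟨
  2 ^ suc t * L                          ∎
  where open ≡-Reasoning

weightedSum-≥ : ∀ t (ℓ : Fin (suc t) → ℕ) {L} → 2 ≤ ℓ fzero → (∀ i → L ≤ ℓ (fsuc i)) →
                L * (2 ^ suc t ∸ 2) ≤ weightedSum (suc t) ℓ ∸ 2
weightedSum-≥ t ℓ {L} 2≤ℓ₀ L≤ℓ = begin
  L * (2 ^ suc t ∸ 2)       ≡⟨ *-comm L _ ⟩
  (2 ^ suc t ∸ 2) * L       ≡⟨ *-distribʳ-∸ L (2 ^ suc t) 2 ⟩
  2 ^ suc t * L ∸ 2 * L     ≡⟨ cong (_∸ 2 * L) (*-assoc 2 (2 ^ t) L) ⟩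
  2 * (2 ^ t * L) ∸ 2 * L   ≡⟨ cong (λ m → 2 * m ∸ 2 * L) (weightedSum-const t L) ⟨
  2 * (C + L) ∸ 2 * L       ≡⟨ cong (_∸ 2 * L) (*-distribˡ-+ 2 C L) ⟩
  2 * C + 2 * L ∸ 2 * L     ≡⟨ m+n∸n≡m (2 * C) (2 * L) ⟩
  2 * C                     ≤⟨ *-monoʳ-≤ 2 (weightedSum-mono-≤ t L≤ℓ) ⟩
  2 * S                     ≤⟨ m≤n+m (2 * S) (ℓ fzero ∸ 2) ⟩
  ℓ fzero ∸ 2 + 2 * S       ≡⟨ +-∸-comm (2 * S) 2≤ℓ₀ ⟨
  ℓ fzero + 2 * S ∸ 2       ≡⟨ cong (_∸ 2) (weightedSum-suc t ℓ) ⟨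
  weightedSum (suc t) ℓ ∸ 2 ∎
  where
  open ≤-Reasoning
  C S : ℕ
  C = weightedSum t (const L)
  S = weightedSum t (ℓ ∘ fsuc)

≤-floorDiv : ∀ {q d m} → 0 < d → q * d ≤ m → q ≤ floorDiv m d
≤-floorDiv {q} {suc d} {m} _ qd≤m = subst (_≤ m / suc d) (m*n/n≡m q (suc d)) (/-mono-≤ qd≤m ≤-refl)

2^[2+t]∸2>0 : ∀ t → 0 < 2 ^ (2 + t) ∸ 2
2^[2+t]∸2>0 t = m+n≤o⇒m≤o∸n 1 (≤-trans (n≤1+n 3) (^-monoʳ-≤ 2 {2} {2 + t} (s≤s (s≤s z≤n))))

lemma6 : (t : ℕ) → 3 ≤ t → (ℓ : Fin t → ℕ) →
         (∀ i → 2 ≤ ℓ i) →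
         (∀ i j → i ≤ᶠ j → ℓ i ≤ ℓ j) →
         (∀ i → toℕ i ≡ 0 → ℓ i ≤ 3) →
         PathRamseyAtMost t ℓ (floorDiv (weightedSum t ℓ ∸ 2) (2 ^ t ∸ 2))
lemma6 (suc (suc (suc t))) (s≤s (s≤s (s≤s _))) ℓ 2≤ℓ ℓ-mono ℓ₀≤3 =
  ℓ (fsuc fzero) ,
  ≤-floorDiv (2^[2+t]∸2>0 (suc t))
    (weightedSum-≥ (suc (suc t)) ℓ (2≤ℓ fzero) (λ i → ℓ-mono (fsuc fzero) (fsuc i) (s≤s z≤n))) ,
  Good-ℓⱼ ℓ fzero (fsuc fzero) (λ ()) (2≤ℓ (fsuc fzero)) (ℓ₀≤3 fzero refl) (ℓ-mono fzero (fsuc fzero) z≤n)
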